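{- Let $(a_n)_{n\ge0}$ be a sequence, extended to negative indices by $a_{ -n}=a_n$. Let $\mathbb{B}=(b_{n,k})_{n,k\ge0}=L\cdot(1+x,x)^t$ where $L=\left(\frac{1-x}{1+x^2},\frac{x}{1+x^2}\right)^{ -1}$ (equivalently, $b_{n,k}=\binom{n}{\lfloor\frac{n-k}{2}\rfloor}+\binom{n}{\lfloor\frac{n-k+1}{2}\rfloor}-\binom{n}{\lfloor\frac n2\rfloor}[k=0]$, with $\binom{n}{m}=0$ for $m<0$), and let $b_n=\sum_{k=0}^{n+1}b_{n,k}a_k$. Then $$b_n=\sum_{k=0}^n\binom{n}{k}\big(a_{n-2k}+a_{n-2k+1}\big).$$
   Context: A Riordan array $(g,f)$, where $g(x)=1+g_1x+\cdots$ and $f(x)=x+f_2x^2+\cdots$ are formal power series, is the infinite lower-triangular matrix (rows and columns indexed from $0$) whose $k$-th column has ordinary generating function $g(x)f(x)^k$. The matrix $L$ has $(n,k)$ entry $\binom{n}{\lfloor\frac{n-k}{2}\rfloor}$ (zero for $k>n$). $M^t$ denotes the transpose; $(1+x,x)^t$ is the upper-triangular matrix with $1$ on the main diagonal and first superdiagonal and $0$ elsewhere. $[k=0]$ is $1$ if $k=0$ and $0$ otherwise. -}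

module Defs where

open import Level using (Level)
open import Data.Nat using (ℕ; zero; suc; _+_; _*_; _∸_; _/_; _≤?_; _≟_)
open import Data.Nat.Combinatorics using (_C_)
open import Data.Integer as ℤ using (ℤ; ∣_∣)
open import Relation.Nullary.Decidable using (does)
open import Data.Bool using (if_then_else_)
open import Algebra.Bundles using (CommutativeRing)
import Algebra.Definitions.RawMonoid as RM

sumTo : {a : Level} {A : Set a} → (A → A → A) → A → ℕ → (ℕ → A) → A
sumTo _⊕_ e zero    f = f 0
sumTo _⊕_ e (suc m) f = sumTo _⊕_ e m f ⊕ f (suc m)

Lmat : ℕ → ℕ → ℕ
Lmat n k = if does (k ≤? n) then n C ((n ∸ k) / 2) else 0

-- (1+x, x)^t : upper triangular, 1 on the diagonal and first superdiagonal
Umat : ℕ → ℕ → ℕ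
Umat j k = if does (j ≟ k) then 1 else (if does (suc j ≟ k) then 1 else 0)

-- B = L · (1+x,x)^t ; since Umat j k = 0 for j > k, the sum over j stops at k
Bmat : ℕ → ℕ → ℕ
Bmat n k = sumTo _+_ 0 k (λ j → Lmat n j * Umat j k)

module _ {c ℓ : Level} (R : CommutativeRing c ℓ) where
  open CommutativeRing R using (Carrier; 0#) renaming (_+_ to _+R_; +-rawMonoid to +R-rawMonoid)
  open RM +R-rawMonoid using (_×_)

  aExt : (ℕ → Carrier) → ℤ → Carrier
  aExt a i = a ∣ i ∣

  bSeq : (ℕ → Carrier) → ℕ → Carrier
  bSeq a n = sumTo _+R_ 0# (suc n) (λ k → Bmat n k × a k)

  rhsSeq : (ℕ → Carrier) → ℕ → Carrier
  rhsSeq a n = sumTo _+R_ 0# n (λ k →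
    (n C k) × (aExt a (ℤ.+ n ℤ.- ℤ.+ (2 * k)) +R aExt a (ℤ.+ n ℤ.- ℤ.+ (2 * k) ℤ.+ ℤ.+ 1)))

module Submission where

-- Write d k = a k + a (k+1).  Since B = L·(1+x,x)ᵗ, the column
-- k of B is the sum of the columns k and k-1 of L, so
--     b_n = Σ_k L(n,k) (a_k + a_{k+1}) = Σ_k L(n,k) d_k.
-- The right-hand side is Σ_j C(n,j) D(n-2j), where D is the extension of d to ℤ
-- by the reflection D(-1-m) = D(m), which is exactly what the convention
-- a_{-m} = a_m produces.  The identity
--     Σ_k L(n,k) d_k = Σ_j C(n,j) D(n-2j)                         (⋆)
-- holds for every d and is proved by induction on n.  The rows of L satisfy the
-- Pascal-like recurrence L(n+1,k+1) = L(n,k) + L(n,k+2), L(n+1,0) = L(n,0) + L(n,1),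
-- so the left side of (⋆) at n+1 is the left side at n applied to the
-- neighbour sum d_{k+1} + d_{k-1} (with reflecting boundary d_{-1} = d_0);
-- by Pascal's rule the right side satisfies the same step with D(z+1) + D(z-1).

open import Defs
open import Level using (Level)
open import Data.Nat
  using (ℕ; zero; suc; pred; _+_; _*_; _∸_; _<_; _≤_; _≤?_; _≟_; z≤n; s≤s; ⌊_/2⌋; ⌈_/2⌉)
open import Data.Nat.Properties
open import Data.Nat.DivMod using (_/_; m/n≡1+[m∸n]/n)
open import Data.Nat.Combinatorics using (_C_; nCk+nC[k+1]≡[n+1]C[k+1]; k>n⇒nCk≡0; nCk≡nC[n∸k])
open import Data.Integer as ℤ using (ℤ; -[1+_]; ∣_∣)
open import Data.Integer.Tactic.RingSolver using (solve-∀)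
open import Data.Product using (_,_)
open import Function using (_∘_)
open import Data.Bool using (if_then_else_)
open import Relation.Nullary using (yes; no)
open import Relation.Nullary.Decidable using (does; dec-true; dec-false)
open import Relation.Binary.PropositionalEquality
open import Algebra.Bundles using (CommutativeMonoid; CommutativeRing)

-- Division by 2 agrees with the structurally recursive ⌊_/2⌋, which computes
-- by two-step pattern matching.
/2≡⌊/2⌋ : ∀ m → m / 2 ≡ ⌊ m /2⌋
/2≡⌊/2⌋ zero          = refl
/2≡⌊/2⌋ (suc zero)    = refl
/2≡⌊/2⌋ (suc (suc m)) = trans (m/n≡1+[m∸n]/n {suc (suc m)} {2} (s≤s (s≤s z≤n))) (cong suc (/2≡⌊/2⌋ m))

L-above : ∀ {n k} → n < k → Lmat n k ≡ 0
L-above {n} {k} n<k = cong (λ b → if b then n C ((n ∸ k) / 2) else 0) (dec-false (k ≤? n) (<⇒≱ n<k))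

L-below : ∀ {n k} → k ≤ n → Lmat n k ≡ n C ⌊ (n ∸ k) /2⌋
L-below {n} {k} k≤n =
  trans (cong (λ b → if b then n C ((n ∸ k) / 2) else 0) (dec-true (k ≤? n) k≤n))
        (cong (n C_) (/2≡⌊/2⌋ (n ∸ k)))

L-offset : ∀ k m → Lmat (k + m) k ≡ (k + m) C ⌊ m /2⌋
L-offset k m = trans (L-below (m≤m+n k m)) (cong (λ i → (k + m) C ⌊ i /2⌋) (m+n∸m≡n k m))

-- Row recurrence of L off the first column: L(n+1,k+1) = L(n,k) + L(n,k+2).
-- Writing n = k + m, it is trivial for m < 2 and Pascal's rule for m ≥ 2.
L-step : ∀ n k → Lmat (suc n) (suc k) ≡ Lmat n k + Lmat n (suc (suc k))
L-step n k with k ≤? n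
... | no k≰n = begin
  Lmat (suc n) (suc k)                ≡⟨ L-above (s≤s (≰⇒> k≰n)) ⟩
  0                                   ≡⟨ sym (cong₂ _+_ (L-above (≰⇒> k≰n)) (L-above (m<n⇒m<1+n (m<n⇒m<1+n (≰⇒> k≰n))))) ⟩
  Lmat n k + Lmat n (suc (suc k))     ∎
  where open ≡-Reasoning
... | yes k≤n with m≤n⇒∃[o]m+o≡n k≤n
...   | m , refl = offset-step m
  where
  open ≡-Reasoning
  offset-step : ∀ m → Lmat (suc (k + m)) (suc k) ≡ Lmat (k + m) k + Lmat (k + m) (suc (suc k))
  offset-step zero =
    trans (L-offset (suc k) 0) (sym (cong₂ _+_ (L-offset k 0) (L-above (s≤s (m≤n⇒m≤1+n (≤-reflexive (+-identityʳ k)))))))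
  offset-step (suc zero) =
    trans (L-offset (suc k) 1) (sym (cong₂ _+_ (L-offset k 1) (L-above (s≤s (≤-reflexive (+-comm k 1))))))
  offset-step (suc (suc m)) = begin
    Lmat (suc N) (suc k)                ≡⟨ L-offset (suc k) (suc (suc m)) ⟩
    suc N C suc q                       ≡⟨ sym (nCk+nC[k+1]≡[n+1]C[k+1] N q) ⟩
    N C q + N C suc q                   ≡⟨ +-comm (N C q) _ ⟩
    N C suc q + N C q                   ≡⟨ cong₂ _+_ (sym (L-offset k (suc (suc m)))) (sym far) ⟩
    Lmat N k + Lmat N (suc (suc k))     ∎
    where
    N = k + suc (suc m)
    q = ⌊ m /2⌋
    far : Lmat N (suc (suc k)) ≡ N C q
    far = subst (λ M → Lmat M (suc (suc k)) ≡ M C q)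
                (trans (sym (+-suc (suc k) m)) (sym (+-suc k (suc m))))
                (L-offset (suc (suc k)) m)

central-symmetry : ∀ n → n C ⌈ n /2⌉ ≡ n C ⌊ n /2⌋
central-symmetry n = trans (nCk≡nC[n∸k] (⌈n/2⌉≤n n)) (cong (n C_) n∸⌈n/2⌉≡⌊n/2⌋)
  where
  n∸⌈n/2⌉≡⌊n/2⌋ : n ∸ ⌈ n /2⌉ ≡ ⌊ n /2⌋
  n∸⌈n/2⌉≡⌊n/2⌋ = trans (cong (_∸ ⌈ n /2⌉) (sym (⌊n/2⌋+⌈n/2⌉≡n n))) (m+n∸n≡m ⌊ n /2⌋ ⌈ n /2⌉)

L-step-zero : ∀ n → Lmat (suc n) 0 ≡ Lmat n 0 + Lmat n 1
L-step-zero zero = refl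
L-step-zero (suc n) = begin
  Lmat (suc (suc n)) 0                  ≡⟨ L-below {suc (suc n)} z≤n ⟩
  suc (suc n) C suc ⌊ n /2⌋             ≡⟨ sym (nCk+nC[k+1]≡[n+1]C[k+1] (suc n) ⌊ n /2⌋) ⟩
  suc n C ⌊ n /2⌋ + suc n C ⌈ suc n /2⌉ ≡⟨ +-comm (suc n C ⌊ n /2⌋) _ ⟩
  suc n C ⌈ suc n /2⌉ + suc n C ⌊ n /2⌋ ≡⟨ cong₂ _+_ (central-symmetry (suc n)) refl ⟩
  suc n C ⌊ suc n /2⌋ + suc n C ⌊ n /2⌋ ≡⟨ sym (cong₂ _+_ (L-below {suc n} z≤n) (L-below {suc n} (s≤s z≤n))) ⟩
  Lmat (suc n) 0 + Lmat (suc n) 1       ∎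
  where open ≡-Reasoning

shift : (ℕ → ℕ) → ℕ → ℕ
shift c zero    = 0
shift c (suc k) = c k

U-diagonal : ∀ j → Umat j j ≡ 1
U-diagonal j = cong (λ b → if b then 1 else (if does (suc j ≟ j) then 1 else 0)) (dec-true (j ≟ j) refl)

U-superdiagonal : ∀ j → Umat j (suc j) ≡ 1
U-superdiagonal j =
  trans (cong (λ b → if b then 1 else (if does (suc j ≟ suc j) then 1 else 0)) (dec-false (j ≟ suc j) (<⇒≢ (n<1+n j))))
        (cong (λ b → if b then 1 else 0) (dec-true (suc j ≟ suc j) refl))

U-far : ∀ {j k} → suc j < k → Umat j k ≡ 0
U-far {j} {k} j+1<k =
  trans (cong (λ b → if b then 1 else (if does (suc j ≟ k) then 1 else 0)) (dec-false (j ≟ k) (<⇒≢ (<-trans (n<1+n j) j+1<k))))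
        (cong (λ b → if b then 1 else 0) (dec-false (suc j ≟ k) (<⇒≢ j+1<k)))

B-columns : ∀ n k → Bmat n k ≡ Lmat n k + shift (Lmat n) k
B-columns n zero    = trans (*-identityʳ (Lmat n 0)) (sym (+-identityʳ (Lmat n 0)))
B-columns n (suc k) = begin
  Bmat n (suc k)                                          ≡⟨ cong₂ _+_ (superdiagonal-part k) (cong (Lmat n (suc k) *_) (U-diagonal (suc k))) ⟩
  Lmat n k + Lmat n (suc k) * 1                           ≡⟨ cong (Lmat n k +_) (*-identityʳ (Lmat n (suc k))) ⟩
  Lmat n k + Lmat n (suc k)                               ≡⟨ +-comm (Lmat n k) _ ⟩
  Lmat n (suc k) + Lmat n k                               ∎
  where
  open ≡-Reasoning
  vanishing : ∀ i {K} → suc i < K → sumTo _+_ 0 i (λ j → Lmat n j * Umat j K) ≡ 0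
  vanishing zero    lt = trans (cong (Lmat n 0 *_) (U-far lt)) (*-zeroʳ (Lmat n 0))
  vanishing (suc i) lt = cong₂ _+_ (vanishing i (<-trans (n<1+n (suc i)) lt))
                                   (trans (cong (Lmat n (suc i) *_) (U-far lt)) (*-zeroʳ (Lmat n (suc i))))
  superdiagonal-part : ∀ k → sumTo _+_ 0 k (λ j → Lmat n j * Umat j (suc k)) ≡ Lmat n k
  superdiagonal-part zero    = trans (cong (Lmat n 0 *_) (U-superdiagonal 0)) (*-identityʳ (Lmat n 0))
  superdiagonal-part (suc k) =
    trans (cong₂ _+_ (vanishing k ≤-refl) (cong (Lmat n (suc k) *_) (U-superdiagonal (suc k))))
          (*-identityʳ (Lmat n (suc k)))

index-up : ∀ n j → ℤ.+ suc n ℤ.- ℤ.+ (2 * j) ≡ (ℤ.+ n ℤ.- ℤ.+ (2 * j)) ℤ.+ ℤ.+ 1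
index-up n j = shift-up (ℤ.+ n) (ℤ.+ (2 * j))
  where
  shift-up : ∀ (x y : ℤ) → (ℤ.+ 1 ℤ.+ x) ℤ.- y ≡ (x ℤ.- y) ℤ.+ ℤ.+ 1
  shift-up = solve-∀

index-down : ∀ n j → ℤ.+ suc n ℤ.- ℤ.+ (2 * suc j) ≡ (ℤ.+ n ℤ.- ℤ.+ (2 * j)) ℤ.- ℤ.+ 1
index-down n j = trans (cong (λ i → ℤ.+ suc n ℤ.- ℤ.+ i) (*-suc 2 j)) (shift-down (ℤ.+ n) (ℤ.+ (2 * j)))
  where
  shift-down : ∀ (x y : ℤ) → (ℤ.+ 1 ℤ.+ x) ℤ.- (ℤ.+ 2 ℤ.+ y) ≡ (x ℤ.- y) ℤ.- ℤ.+ 1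
  shift-down = solve-∀

-- Identity (⋆) for weighted sums with natural-number weights in a commutative
-- monoid; n × x denotes the n-fold sum of x, as in the definition of b_n.
module WeightedSums {a ℓ : Level} (M : CommutativeMonoid a ℓ) where
  open CommutativeMonoid M
    hiding (setoid)
    renaming (refl to ≈-refl; sym to ≈-sym; trans to ≈-trans; reflexive to ≈-reflexive)
  open import Algebra.Properties.CommutativeMonoid.Mult M using (_×_; ×-congʳ; ×-homo-+; ×-distrib-+)
  open import Algebra.Properties.CommutativeSemigroup commutativeSemigroup using (interchange)
  open import Relation.Binary.Reasoning.Setoid (CommutativeMonoid.setoid M)

  Σ : ℕ → (ℕ → Carrier) → Carrier
  Σ N f = sumTo _∙_ ε N f

  Σ-cong : ∀ N {f g} → (∀ k → f k ≈ g k) → Σ N f ≈ Σ N g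
  Σ-cong zero    f≈g = f≈g 0
  Σ-cong (suc N) f≈g = ∙-cong (Σ-cong N f≈g) (f≈g (suc N))

  Σ-∙ : ∀ N f g → Σ N (λ k → f k ∙ g k) ≈ Σ N f ∙ Σ N g
  Σ-∙ zero    f g = ≈-refl
  Σ-∙ (suc N) f g = ≈-trans (∙-congʳ (Σ-∙ N f g)) (interchange _ _ _ _)

  Σ-head : ∀ N f → Σ (suc N) f ≈ f 0 ∙ Σ N (λ k → f (suc k))
  Σ-head zero    f = ≈-refl
  Σ-head (suc N) f = ≈-trans (∙-congʳ (Σ-head N f)) (assoc _ _ _)

  dot : ℕ → (ℕ → ℕ) → (ℕ → Carrier) → Carrier
  dot N c d = Σ N (λ k → c k × d k)

  dot-cong : ∀ N {c c′ d d′} → (∀ k → c k ≡ c′ k) → (∀ k → d k ≈ d′ k) → dot N c d ≈ dot N c′ d′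
  dot-cong N {c′ = c′} c≡c′ d≈d′ = Σ-cong N (λ k → ≈-trans (≈-reflexive (cong (_× _) (c≡c′ k))) (×-congʳ (c′ k) (d≈d′ k)))

  dot-+ˡ : ∀ N c c′ d → dot N (λ k → c k + c′ k) d ≈ dot N c d ∙ dot N c′ d
  dot-+ˡ N c c′ d = ≈-trans (Σ-cong N (λ k → ×-homo-+ (d k) (c k) (c′ k))) (Σ-∙ N _ _)

  dot-∙ʳ : ∀ N c d d′ → dot N c (λ k → d k ∙ d′ k) ≈ dot N c d ∙ dot N c d′
  dot-∙ʳ N c d d′ = ≈-trans (Σ-cong N (λ k → ×-distrib-+ (d k) (d′ k) (c k))) (Σ-∙ N _ _)

  dot-trim : ∀ N c d → c (suc N) ≡ 0 → dot (suc N) c d ≈ dot N c d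
  dot-trim N c d c≡0 = ≈-trans (∙-congˡ (≈-reflexive (cong (_× d (suc N)) c≡0))) (identityʳ _)

  dot-shift : ∀ N c d → dot N c (d ∘ suc) ≈ dot (suc N) (shift c) d
  dot-shift N c d = ≈-sym (≈-trans (Σ-head N _) (identityˡ _))

  fold : (ℕ → ℕ) → ℕ → ℕ
  fold c zero    = c 0 + c 1
  fold c (suc k) = c (suc (suc k))

  dot-fold : ∀ N c d → dot (suc (suc N)) c (d ∘ pred) ≈ dot (suc N) (fold c) d
  dot-fold N c d = begin
    dot (suc (suc N)) c (d ∘ pred)                            ≈⟨ Σ-head (suc N) _ ⟩
    c 0 × d 0 ∙ dot (suc N) (c ∘ suc) d                       ≈⟨ ∙-congˡ (Σ-head N _) ⟩
    c 0 × d 0 ∙ (c 1 × d 0 ∙ dot N (fold c ∘ suc) (d ∘ suc))  ≈⟨ ≈-sym (assoc _ _ _) ⟩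
    (c 0 × d 0 ∙ c 1 × d 0) ∙ dot N (fold c ∘ suc) (d ∘ suc)  ≈⟨ ∙-congʳ (≈-sym (×-homo-+ (d 0) (c 0) (c 1))) ⟩
    fold c 0 × d 0 ∙ dot N (fold c ∘ suc) (d ∘ suc)           ≈⟨ ≈-sym (Σ-head N _) ⟩
    dot (suc N) (fold c) d                                    ∎

  L-row : ℕ → (ℕ → Carrier) → Carrier
  L-row n d = dot n (Lmat n) d

  C-row : ℕ → (ℤ → Carrier) → Carrier
  C-row n D = dot n (n C_) (λ j → D (ℤ.+ n ℤ.- ℤ.+ (2 * j)))

  mirror : (ℕ → Carrier) → ℤ → Carrier
  mirror d (ℤ.+ m)   = d m
  mirror d -[1+ m ]  = d m

  neighbours : (ℕ → Carrier) → ℕ → Carrier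
  neighbours d k = d (suc k) ∙ d (pred k)

  -- Neighbour sums on ℕ become sums of the two translates on ℤ, because the
  -- reflecting boundary d_{-1} = d_0 is the one built into mirror.
  mirror-neighbours : ∀ d z → mirror (neighbours d) z ≈ mirror d (z ℤ.+ ℤ.+ 1) ∙ mirror d (z ℤ.- ℤ.+ 1)
  mirror-neighbours d (ℤ.+ zero)       = ≈-refl
  mirror-neighbours d (ℤ.+ suc m)      = ∙-congʳ (≈-reflexive (cong d (+-comm 1 (suc m))))
  mirror-neighbours d -[1+ zero ]      = comm _ _
  mirror-neighbours d -[1+ suc m ]     =
    ≈-trans (comm _ _) (∙-congˡ (≈-reflexive (cong (d ∘ suc ∘ suc) (sym (+-identityʳ m)))))

  L-row-step : ∀ n d → L-row (suc n) d ≈ L-row n (neighbours d)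
  L-row-step n d = begin
    dot (suc n) (Lmat (suc n)) d                                  ≈⟨ dot-cong (suc n) L-split (λ _ → ≈-refl) ⟩
    dot (suc n) (λ k → shift (Lmat n) k + fold (Lmat n) k) d      ≈⟨ dot-+ˡ (suc n) (shift (Lmat n)) (fold (Lmat n)) d ⟩
    dot (suc n) (shift (Lmat n)) d ∙ dot (suc n) (fold (Lmat n)) d ≈⟨ ∙-cong (≈-sym (dot-shift n (Lmat n) d)) (≈-sym (dot-fold n (Lmat n) d)) ⟩
    dot n (Lmat n) (d ∘ suc) ∙ dot (suc (suc n)) (Lmat n) (d ∘ pred) ≈⟨ ∙-congˡ beyond-row ⟩
    dot n (Lmat n) (d ∘ suc) ∙ dot n (Lmat n) (d ∘ pred)           ≈⟨ ≈-sym (dot-∙ʳ n (Lmat n) (d ∘ suc) (d ∘ pred)) ⟩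
    L-row n (neighbours d)                                        ∎
    where
    L-split : ∀ k → Lmat (suc n) k ≡ shift (Lmat n) k + fold (Lmat n) k
    L-split zero    = L-step-zero n
    L-split (suc k) = L-step n k
    beyond-row : dot (suc (suc n)) (Lmat n) (d ∘ pred) ≈ dot n (Lmat n) (d ∘ pred)
    beyond-row = ≈-trans (dot-trim (suc n) (Lmat n) (d ∘ pred) (L-above (m<n⇒m<1+n (n<1+n n))))
                         (dot-trim n (Lmat n) (d ∘ pred) (L-above (n<1+n n)))

  C-row-step : ∀ n D → C-row (suc n) D ≈ C-row n (λ z → D (z ℤ.+ ℤ.+ 1)) ∙ C-row n (λ z → D (z ℤ.- ℤ.+ 1))
  C-row-step n D = begin
    dot (suc n) (suc n C_) e                                      ≈⟨ dot-cong (suc n) pascal (λ _ → ≈-refl) ⟩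
    dot (suc n) (λ k → n C k + shift (n C_) k) e                  ≈⟨ dot-+ˡ (suc n) (n C_) (shift (n C_)) e ⟩
    dot (suc n) (n C_) e ∙ dot (suc n) (shift (n C_)) e           ≈⟨ ∙-cong (dot-trim n (n C_) e (k>n⇒nCk≡0 (n<1+n n))) (≈-sym (dot-shift n (n C_) e)) ⟩
    dot n (n C_) e ∙ dot n (n C_) (e ∘ suc)                       ≈⟨ ∙-cong (reindex (index-up n)) (reindex (index-down n)) ⟩
    C-row n (λ z → D (z ℤ.+ ℤ.+ 1)) ∙ C-row n (λ z → D (z ℤ.- ℤ.+ 1)) ∎
    where
    e : ℕ → Carrier
    e j = D (ℤ.+ suc n ℤ.- ℤ.+ (2 * j))
    pascal : ∀ k → suc n C k ≡ n C k + shift (n C_) k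
    pascal zero    = refl
    pascal (suc k) = trans (sym (nCk+nC[k+1]≡[n+1]C[k+1] n k)) (+-comm (n C k) _)
    reindex : ∀ {f g : ℕ → ℤ} → (∀ j → f j ≡ g j) → dot n (n C_) (D ∘ f) ≈ dot n (n C_) (D ∘ g)
    reindex f≡g = dot-cong n {n C_} (λ _ → refl) (λ j → ≈-reflexive (cong D (f≡g j)))

  C-row-cong : ∀ n {D D′} → (∀ z → D z ≈ D′ z) → C-row n D ≈ C-row n D′
  C-row-cong n D≈D′ = dot-cong n {n C_} (λ _ → refl) (λ j → D≈D′ _)

  L-row≈C-row : ∀ n d → L-row n d ≈ C-row n (mirror d)
  L-row≈C-row zero    d = ≈-refl
  L-row≈C-row (suc n) d = begin
    L-row (suc n) d                                               ≈⟨ L-row-step n d ⟩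
    L-row n (neighbours d)                                        ≈⟨ L-row≈C-row n (neighbours d) ⟩
    C-row n (mirror (neighbours d))                               ≈⟨ C-row-cong n (mirror-neighbours d) ⟩
    C-row n (λ z → mirror d (z ℤ.+ ℤ.+ 1) ∙ mirror d (z ℤ.- ℤ.+ 1)) ≈⟨ dot-∙ʳ n (n C_) (λ j → mirror d (node j ℤ.+ ℤ.+ 1)) (λ j → mirror d (node j ℤ.- ℤ.+ 1)) ⟩
    C-row n (λ z → mirror d (z ℤ.+ ℤ.+ 1)) ∙ C-row n (λ z → mirror d (z ℤ.- ℤ.+ 1)) ≈⟨ ≈-sym (C-row-step n (mirror d)) ⟩
    C-row (suc n) (mirror d)                                      ∎
    where
    node : ℕ → ℤ
    node j = ℤ.+ n ℤ.- ℤ.+ (2 * j)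

  pair-sums : (ℕ → Carrier) → ℕ → Carrier
  pair-sums a k = a k ∙ a (suc k)

  B-row≈L-row : ∀ n a → dot (suc n) (Bmat n) a ≈ L-row n (pair-sums a)
  B-row≈L-row n a = begin
    dot (suc n) (Bmat n) a                                        ≈⟨ dot-cong (suc n) (B-columns n) (λ _ → ≈-refl) ⟩
    dot (suc n) (λ k → Lmat n k + shift (Lmat n) k) a             ≈⟨ dot-+ˡ (suc n) (Lmat n) (shift (Lmat n)) a ⟩
    dot (suc n) (Lmat n) a ∙ dot (suc n) (shift (Lmat n)) a       ≈⟨ ∙-cong (dot-trim n (Lmat n) a (L-above (n<1+n n))) (≈-sym (dot-shift n (Lmat n) a)) ⟩
    dot n (Lmat n) a ∙ dot n (Lmat n) (a ∘ suc)                   ≈⟨ ≈-sym (dot-∙ʳ n (Lmat n) a (a ∘ suc)) ⟩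
    L-row n (pair-sums a)                                         ∎

  pairs-mirror : ∀ a z → a ∣ z ∣ ∙ a ∣ z ℤ.+ ℤ.+ 1 ∣ ≈ mirror (pair-sums a) z
  pairs-mirror a (ℤ.+ m)        = ∙-congˡ (≈-reflexive (cong a (+-comm m 1)))
  pairs-mirror a -[1+ zero ]    = comm _ _
  pairs-mirror a -[1+ suc m ]   = comm _ _

mainTheorem5 : {c ℓ : Level} (R : CommutativeRing c ℓ) (a : ℕ → CommutativeRing.Carrier R) (n : ℕ) →
    CommutativeRing._≈_ R (bSeq R a n) (rhsSeq R a n)
mainTheorem5 R a n = begin
  bSeq R a n                              ≈⟨ B-row≈L-row n a ⟩
  L-row n (pair-sums a)                   ≈⟨ L-row≈C-row n (pair-sums a) ⟩
  C-row n (mirror (pair-sums a))          ≈⟨ C-row-cong n (λ z → ≈-sym (pairs-mirror a z)) ⟩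
  rhsSeq R a n                            ∎
  where
  open CommutativeRing R using (+-commutativeMonoid) renaming (sym to ≈-sym)
  open WeightedSums +-commutativeMonoid
  open import Relation.Binary.Reasoning.Setoid (CommutativeRing.setoid R)
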